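{- Let $q$ be a prime power and $n\ge 2$ an integer. Let $S$ be an $(n-1)$-dimensional $\mathbb{F}_q$-subspace of $\mathbb{F}_{q^n}$ and let $\gamma\in\mathbb{F}_{q^n}^*$ be such that $\mathbb{F}_q(\gamma)=\mathbb{F}_{q^n}$. Then there exists $c\in\mathbb{F}_{q^n}^*$ such that $S=c\,\langle 1,\gamma,\ldots,\gamma^{n-2}\rangle_{\mathbb{F}_q}$.
   Context: $\langle v_1,\ldots,v_k\rangle_{\mathbb{F}_q}$ denotes the $\mathbb{F}_q$-span, and $cT=\{ct: t\in T\}$. -}

module Defs where

open import Level using (Level; _⊔_) renaming (suc to lsuc)
open import Algebra.Bundles using (CommutativeRing)
open import Data.Nat using (ℕ; zero; suc) renaming (_^_ to _^ℕ_)
open import Data.Nat.Primality using (Prime)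
open import Data.Fin using (Fin; zero; suc; toℕ)
open import Data.Product using (Σ; ∃; ∃-syntax; _×_; _,_)
open import Data.Unit.Polymorphic using (⊤)
open import Relation.Nullary using (¬_)
open import Relation.Binary.PropositionalEquality using (_≡_)
open import Function.Bundles using (_⇔_)

IsPrimePower : ℕ → Set
IsPrimePower q = ∃[ p ] ∃[ k ] (Prime p × q ≡ p ^ℕ suc k)

module FieldTheory {c ℓ : Level} (K : CommutativeRing c ℓ) where
  open CommutativeRing K hiding (zero)

  Subset : Set (lsuc (c ⊔ ℓ))
  Subset = Carrier → Set (c ⊔ ℓ)

  IsField : Set (c ⊔ ℓ)
  IsField = (¬ (1# ≈ 0#)) × (∀ x → ¬ (x ≈ 0#) → ∃[ y ] (x * y ≈ 1#))

  IsFinite : Set (c ⊔ ℓ)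
  IsFinite = ∃[ N ] Σ (Fin N → Carrier) (λ f → ∀ x → ∃[ i ] (f i ≈ x))

  Respects : Subset → Set (c ⊔ ℓ)
  Respects P = ∀ {x y} → x ≈ y → P x → P y

  IsSubfield : Subset → Set (c ⊔ ℓ)
  IsSubfield F = Respects F × F 0# × F 1#
    × (∀ x y → F x → F y → F (x + y))
    × (∀ x → F x → F (- x))
    × (∀ x y → F x → F y → F (x * y))
    × (∀ x y → F x → x * y ≈ 1# → F y)

  HasCard : Subset → ℕ → Set (c ⊔ ℓ)
  HasCard F q = Σ (Fin q → Carrier) λ f →
    (∀ i → F (f i)) × (∀ i j → f i ≈ f j → i ≡ j) × (∀ x → F x → ∃[ i ] (f i ≈ x))

  ∑ : {m : ℕ} → (Fin m → Carrier) → Carrier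
  ∑ {zero} v = 0#
  ∑ {suc m} v = v zero + ∑ (λ i → v (suc i))

  pow : Carrier → ℕ → Carrier
  pow x zero = 1#
  pow x (suc k) = x * pow x k

  InSpan : Subset → {m : ℕ} → (Fin m → Carrier) → Carrier → Set (c ⊔ ℓ)
  InSpan F {m} v x = Σ (Fin m → Carrier) λ a → (∀ i → F (a i)) × (x ≈ ∑ (λ i → a i * v i))

  LinIndep : Subset → {m : ℕ} → (Fin m → Carrier) → Set (c ⊔ ℓ)
  LinIndep F {m} v = ∀ (a : Fin m → Carrier) → (∀ i → F (a i))
    → ∑ (λ i → a i * v i) ≈ 0# → ∀ i → a i ≈ 0#

  IsSubspace : Subset → Subset → Set (c ⊔ ℓ)
  IsSubspace F S = Respects S × S 0#
    × (∀ x y → S x → S y → S (x + y))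
    × (∀ a x → F a → S x → S (a * x))

  HasDim : Subset → Subset → ℕ → Set (c ⊔ ℓ)
  HasDim F S m = Σ (Fin m → Carrier) λ v →
    (∀ i → S (v i)) × LinIndep F v × (∀ x → S x → InSpan F v x)

  -- F(γ) = K : the only subfield containing F and γ is K itself
  Generates : Subset → Carrier → Set (lsuc (c ⊔ ℓ))
  Generates F γ = ∀ (L : Subset) → IsSubfield L → (∀ x → F x → L x) → L γ → ∀ x → L x

  scale : Carrier → Subset → Subset
  scale a T x = ∃[ y ] (T y × x ≈ a * y)

  SameSet : Subset → Subset → Set (c ⊔ ℓ)
  SameSet A B = ∀ x → A x ⇔ B x

{-# OPTIONS --safe #-}
module Submission where

-- A hyperplane S of K is cut out by a single F-linear condition, so "c γⁱ ∈ S for i < n−1" are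
-- n−1 linear conditions on c in the n-dimensional K and some c ≠ 0 satisfies them all: c T ⊆ S
-- for T = ⟨1, γ, …, γⁿ⁻²⟩. The powers 1, …, γⁿ⁻² are independent: a relation among them puts
-- γ⁻¹ into their span W, so γ⁻¹ W ⊆ W; the stabiliser of W is a subfield containing F and γ,
-- hence all of K, which would make W = K. So c T and S have equal dimension and coincide.
-- The dimension counting is "p+1 vectors in the span of p are dependent", proved by Gaussian
-- elimination; it is constructive because equality in the finite field F is decidable.

open import Defs
open import Level using (Level; _⊔_)
open import Algebra.Bundles using (CommutativeRing)
open import Data.Nat using (ℕ; zero; suc; _≤_; _∸_; s≤s)
open import Data.Nat.Properties using (≤-refl; m≤n⇒m≤1+n)
open import Data.Fin using (Fin; zero; suc; toℕ; punchIn; inject₁; _≟_)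
open import Data.Fin.Properties using (any?; all?; ¬∀⟶∃¬; toℕ-inject₁; punchIn-punchOut)
open import Data.Vec.Functional using (insertAt; _∷_)
open import Data.Vec.Functional.Properties using (insertAt-lookup; insertAt-punchIn)
open import Data.Product using (Σ-syntax; ∃-syntax; _×_; _,_; proj₁; proj₂)
open import Data.Unit.Polymorphic using (⊤)
open import Data.Empty using (⊥; ⊥-elim)
open import Function using (_∘_)
open import Function.Bundles using (mk⇔)
open import Relation.Nullary using (¬_; Dec; yes; no)
open import Relation.Nullary.Decidable using (¬?; decidable-stable; map′)
import Relation.Binary.PropositionalEquality as ≡

module LinearAlgebra {r ℓ : Level} (K : CommutativeRing r ℓ) where
  open CommutativeRing K hiding (zero)
  open FieldTheory K
  open import Algebra.Properties.Ring ring using (-‿distribˡ-*; -1*x≈-x)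
  open import Algebra.Properties.AbelianGroup +-abelianGroup
    using (inverseˡ-unique; x∙y⁻¹≈ε⇒x≈y; x≈y⇒x∙y⁻¹≈ε; y≈x\\z; \\-leftDividesˡ)
  open import Algebra.Properties.CommutativeSemigroup *-commutativeSemigroup
    using (x∙yz≈y∙xz; xy∙z≈y∙xz)
  open import Algebra.Properties.CommutativeMonoid.Sum +-commutativeMonoid
    using (sum; sum-cong-≋; sum-replicate-zero; sum-remove)
    renaming (∑-distrib-+ to sum-distrib-+; ∑-comm to sum-comm)
  open import Algebra.Properties.Semiring.Sum semiring using (*-distribˡ-sum; *-distribʳ-sum)
  open import Relation.Binary.Reasoning.Setoid setoid

  ∑≈sum : ∀ {m} (f : Fin m → Carrier) → ∑ f ≈ sum f
  ∑≈sum {zero}  f = refl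
  ∑≈sum {suc m} f = +-congˡ (∑≈sum (λ i → f (suc i)))

  ∑-cong : ∀ {m} {f g : Fin m → Carrier} → (∀ i → f i ≈ g i) → ∑ f ≈ ∑ g
  ∑-cong {f = f} {g} f≈g = trans (∑≈sum f) (trans (sum-cong-≋ f≈g) (sym (∑≈sum g)))

  ∑-zero : ∀ {m} {f : Fin m → Carrier} → (∀ i → f i ≈ 0#) → ∑ f ≈ 0#
  ∑-zero {m} f≈0 = trans (∑-cong {m} f≈0) (trans (∑≈sum {m} (λ _ → 0#)) (sum-replicate-zero m))

  ∑-distrib-+ : ∀ {m} (f g : Fin m → Carrier) → ∑ (λ i → f i + g i) ≈ ∑ f + ∑ g
  ∑-distrib-+ f g = begin
    ∑ (λ i → f i + g i)  ≈⟨ ∑≈sum (λ i → f i + g i) ⟩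
    sum (λ i → f i + g i) ≈⟨ sum-distrib-+ f g ⟩
    sum f + sum g        ≈⟨ +-cong (∑≈sum f) (∑≈sum g) ⟨
    ∑ f + ∑ g            ∎

  *-distribˡ-∑ : ∀ {m} x (f : Fin m → Carrier) → x * ∑ f ≈ ∑ (λ i → x * f i)
  *-distribˡ-∑ x f = begin
    x * ∑ f                 ≈⟨ *-congˡ (∑≈sum f) ⟩
    x * sum f               ≈⟨ *-distribˡ-sum x f ⟩
    sum (λ i → x * f i)     ≈⟨ ∑≈sum (λ i → x * f i) ⟨
    ∑ (λ i → x * f i)       ∎

  *-distribʳ-∑ : ∀ {m} x (f : Fin m → Carrier) → ∑ f * x ≈ ∑ (λ i → f i * x)
  *-distribʳ-∑ x f = begin
    ∑ f * x                 ≈⟨ *-congʳ (∑≈sum f) ⟩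
    sum f * x               ≈⟨ *-distribʳ-sum x f ⟩
    sum (λ i → f i * x)     ≈⟨ ∑≈sum (λ i → f i * x) ⟨
    ∑ (λ i → f i * x)       ∎

  ∑-comm : ∀ {m n} (f : Fin m → Fin n → Carrier) →
           ∑ (λ i → ∑ (f i)) ≈ ∑ (λ j → ∑ (λ i → f i j))
  ∑-comm f = begin
    ∑ (λ i → ∑ (f i))              ≈⟨ trans (∑-cong (λ i → ∑≈sum (f i))) (∑≈sum (λ i → sum (f i))) ⟩
    sum (λ i → sum (f i))          ≈⟨ sum-comm f ⟩
    sum (λ j → sum (λ i → f i j))  ≈⟨ trans (∑-cong (λ j → ∑≈sum (λ i → f i j))) (∑≈sum (λ j → sum (λ i → f i j))) ⟨
    ∑ (λ j → ∑ (λ i → f i j))      ∎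

  ∑-remove : ∀ {m} (j : Fin (suc m)) (f : Fin (suc m) → Carrier) →
             ∑ f ≈ f j + ∑ (λ k → f (punchIn j k))
  ∑-remove j f = begin
    ∑ f                              ≈⟨ ∑≈sum f ⟩
    sum f                            ≈⟨ sum-remove {i = j} f ⟩
    f j + sum (λ k → f (punchIn j k)) ≈⟨ +-congˡ (∑≈sum (λ k → f (punchIn j k))) ⟨
    f j + ∑ (λ k → f (punchIn j k))  ∎

  ∑-lincomb-comm : ∀ {m n} (ξ : Fin m → Carrier) (C : Fin m → Fin n → Carrier) (w : Fin n → Carrier) →
                   ∑ (λ j → ξ j * ∑ (λ i → C j i * w i)) ≈ ∑ (λ i → ∑ (λ j → ξ j * C j i) * w i)
  ∑-lincomb-comm ξ C w = begin
    ∑ (λ j → ξ j * ∑ (λ i → C j i * w i))    ≈⟨ ∑-cong (λ j → *-distribˡ-∑ (ξ j) (λ i → C j i * w i)) ⟩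
    ∑ (λ j → ∑ (λ i → ξ j * (C j i * w i)))  ≈⟨ ∑-comm (λ j i → ξ j * (C j i * w i)) ⟩
    ∑ (λ i → ∑ (λ j → ξ j * (C j i * w i)))  ≈⟨ ∑-cong (λ i → ∑-cong (λ j → *-assoc (ξ j) (C j i) (w i))) ⟨
    ∑ (λ i → ∑ (λ j → (ξ j * C j i) * w i))  ≈⟨ ∑-cong (λ i → *-distribʳ-∑ (w i) (λ j → ξ j * C j i)) ⟨
    ∑ (λ i → ∑ (λ j → ξ j * C j i) * w i)    ∎

  *-lincomb : ∀ {m} x (a w : Fin m → Carrier) → x * ∑ (λ i → a i * w i) ≈ ∑ (λ i → a i * (x * w i))
  *-lincomb x a w = begin
    x * ∑ (λ i → a i * w i)        ≈⟨ *-distribˡ-∑ x (λ i → a i * w i) ⟩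
    ∑ (λ i → x * (a i * w i))      ≈⟨ ∑-cong (λ i → x∙yz≈y∙xz x (a i) (w i)) ⟩
    ∑ (λ i → a i * (x * w i))      ∎

  hasCard⇒≈? : ∀ {F q} → HasCard F q → ∀ {x y} → F x → F y → Dec (x ≈ y)
  hasCard⇒≈? (f , _ , f-injective , f-onto) {x} {y} Fx Fy with proj₁ (f-onto x Fx) ≟ proj₁ (f-onto y Fy)
  ... | yes i≡j = yes (trans (sym (proj₂ (f-onto x Fx)))
                              (trans (reflexive (≡.cong f i≡j)) (proj₂ (f-onto y Fy))))
  ... | no i≢j = no (λ x≈y → i≢j (f-injective _ _
                      (trans (proj₂ (f-onto x Fx)) (trans x≈y (sym (proj₂ (f-onto y Fy)))))))

  module OverSubfield (isField : IsField) {F : Subset} (F-subfield : IsSubfield F)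
                      (≈0? : ∀ x → F x → Dec (x ≈ 0#)) where

    1≉0 : ¬ (1# ≈ 0#)
    1≉0 = proj₁ isField

    inverse : ∀ x → ¬ (x ≈ 0#) → ∃[ y ] (x * y ≈ 1#)
    inverse = proj₂ isField

    F-resp : Respects F
    F-resp = proj₁ F-subfield

    F-0 : F 0#
    F-0 = proj₁ (proj₂ F-subfield)

    F-1 : F 1#
    F-1 = proj₁ (proj₂ (proj₂ F-subfield))

    F-+ : ∀ {x y} → F x → F y → F (x + y)
    F-+ = proj₁ (proj₂ (proj₂ (proj₂ F-subfield))) _ _

    F-neg : ∀ {x} → F x → F (- x)
    F-neg = proj₁ (proj₂ (proj₂ (proj₂ (proj₂ F-subfield)))) _

    F-* : ∀ {x y} → F x → F y → F (x * y)
    F-* = proj₁ (proj₂ (proj₂ (proj₂ (proj₂ (proj₂ F-subfield))))) _ _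

    F-inv : ∀ {x y} → F x → x * y ≈ 1# → F y
    F-inv = proj₂ (proj₂ (proj₂ (proj₂ (proj₂ (proj₂ F-subfield))))) _ _

    inverse-cancel : ∀ {x y z} → x * y ≈ 1# → x * z ≈ 0# → z ≈ 0#
    inverse-cancel {x} {y} {z} xy≈1 xz≈0 = begin
      z             ≈⟨ *-identityˡ z ⟨
      1# * z        ≈⟨ *-congʳ xy≈1 ⟨
      (x * y) * z   ≈⟨ xy∙z≈y∙xz x y z ⟩
      y * (x * z)   ≈⟨ *-congˡ xz≈0 ⟩
      y * 0#        ≈⟨ zeroʳ y ⟩
      0#            ∎

    module Subspace {P : Subset} (P-subspace : IsSubspace F P) where

      ∈-resp : Respects P
      ∈-resp = proj₁ P-subspace

      ∈-0 : P 0#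
      ∈-0 = proj₁ (proj₂ P-subspace)

      ∈-+ : ∀ {x y} → P x → P y → P (x + y)
      ∈-+ = proj₁ (proj₂ (proj₂ P-subspace)) _ _

      ∈-* : ∀ {a x} → F a → P x → P (a * x)
      ∈-* = proj₂ (proj₂ (proj₂ P-subspace)) _ _

      ∈-neg : ∀ {x} → P x → P (- x)
      ∈-neg {x} x∈P = ∈-resp (-1*x≈-x x) (∈-* (F-neg F-1) x∈P)

      ∈-∑ : ∀ {m} {a t : Fin m → Carrier} → (∀ i → F (a i)) → (∀ i → P (t i)) →
            P (∑ (λ i → a i * t i))
      ∈-∑ {zero}  Fa t∈P = ∈-0
      ∈-∑ {suc m} Fa t∈P = ∈-+ (∈-* (Fa zero) (t∈P zero)) (∈-∑ (Fa ∘ suc) (t∈P ∘ suc))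

      span-⊆ : ∀ {m} {w : Fin m → Carrier} → (∀ i → P (w i)) → ∀ {x} → InSpan F w x → P x
      span-⊆ w∈P (a , Fa , x≈) = ∈-resp (sym x≈) (∈-∑ Fa w∈P)

      isolate-∈ : ∀ {a y t} → F a → ¬ (a ≈ 0#) → a * y + t ≈ 0# → P t → P y
      isolate-∈ {a} {y} {t} Fa a≉0 ay+t≈0 t∈P =
        ∈-resp y≈-bt (∈-neg (∈-* (F-inv Fa ab≈1) t∈P))
        where
        b = proj₁ (inverse a a≉0)
        ab≈1 = proj₂ (inverse a a≉0)
        y≈-bt : - (b * t) ≈ y
        y≈-bt = sym (inverseˡ-unique y (b * t) (begin
          y + b * t              ≈⟨ +-congʳ (trans (sym (*-identityˡ y)) (*-congʳ (sym ab≈1))) ⟩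
          (a * b) * y + b * t    ≈⟨ +-cong (xy∙z≈y∙xz a b y) (refl {b * t}) ⟩
          b * (a * y) + b * t    ≈⟨ distribˡ b (a * y) t ⟨
          b * (a * y + t)        ≈⟨ *-congˡ ay+t≈0 ⟩
          b * 0#                 ≈⟨ zeroʳ b ⟩
          0#                     ∎))

    open Subspace

    F-isSubspace : IsSubspace F F
    F-isSubspace = F-resp , F-0 , (λ _ _ → F-+) , (λ _ _ → F-*)

    span-isSubspace : ∀ {m} (w : Fin m → Carrier) → IsSubspace F (InSpan F w)
    span-isSubspace w =
        (λ x≈y (a , Fa , x≈) → a , Fa , trans (sym x≈y) x≈)
      , ((λ _ → 0#) , (λ _ → F-0) , sym (∑-zero (λ i → zeroˡ (w i))))
      , (λ x y (a , Fa , x≈) (b , Fb , y≈) → (λ i → a i + b i) , (λ i → F-+ (Fa i) (Fb i)) , (begin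
          x + y                                       ≈⟨ +-cong x≈ y≈ ⟩
          ∑ (λ i → a i * w i) + ∑ (λ i → b i * w i)   ≈⟨ ∑-distrib-+ (λ i → a i * w i) (λ i → b i * w i) ⟨
          ∑ (λ i → a i * w i + b i * w i)             ≈⟨ ∑-cong (λ i → distribʳ (w i) (a i) (b i)) ⟨
          ∑ (λ i → (a i + b i) * w i)                 ∎))
      , (λ k x Fk (a , Fa , x≈) → (λ i → k * a i) , (λ i → F-* Fk (Fa i)) , (begin
          k * x                          ≈⟨ *-congˡ x≈ ⟩
          k * ∑ (λ i → a i * w i)        ≈⟨ *-distribˡ-∑ k (λ i → a i * w i) ⟩
          ∑ (λ i → k * (a i * w i))      ≈⟨ ∑-cong (λ i → *-assoc k (a i) (w i)) ⟨
          ∑ (λ i → (k * a i) * w i)      ∎))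

    span-tail : ∀ {m} (w : Fin (suc m) → Carrier) {x} → InSpan F (w ∘ suc) x → InSpan F w x
    span-tail w (a , Fa , x≈) =
      (0# ∷ a) , (λ { zero → F-0 ; (suc i) → Fa i }) ,
      trans x≈ (trans (sym (+-identityˡ _)) (+-congʳ (sym (zeroˡ (w zero)))))

    span-∈ : ∀ {m} (w : Fin m → Carrier) (j : Fin m) → InSpan F w (w j)
    span-∈ w zero =
      (1# ∷ λ _ → 0#) , (λ { zero → F-1 ; (suc i) → F-0 }) ,
      sym (trans (+-cong (*-identityˡ (w zero)) (∑-zero (λ i → zeroˡ (w (suc i))))) (+-identityʳ _))
    span-∈ w (suc j) = span-tail w (span-∈ (w ∘ suc) j)

    Nontrivial : ∀ {N} → (Fin N → Carrier) → Set ℓ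
    Nontrivial ξ = ∃[ j ] ¬ (ξ j ≈ 0#)

    nontrivial-tail : ∀ {N} {ξ : Fin (suc N) → Carrier} → ξ zero ≈ 0# → Nontrivial ξ → Nontrivial (ξ ∘ suc)
    nontrivial-tail ξ₀≈0 (zero  , ξ₀≉0) = ⊥-elim (ξ₀≉0 ξ₀≈0)
    nontrivial-tail ξ₀≈0 (suc j , ξⱼ≉0) = j , ξⱼ≉0

    Dependent : ∀ {N} → (Fin N → Carrier) → Set (r ⊔ ℓ)
    Dependent u = Σ[ ξ ∈ (Fin _ → Carrier) ] (∀ j → F (ξ j)) × Nontrivial ξ × ∑ (λ j → ξ j * u j) ≈ 0#

    linIndep⇒¬dependent : ∀ {N} {u : Fin N → Carrier} → LinIndep F u → ¬ Dependent u
    linIndep⇒¬dependent u-indep (ξ , Fξ , (j , ξⱼ≉0) , ∑≈0) = ξⱼ≉0 (u-indep ξ Fξ ∑≈0 j)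

    ¬dependent⇒linIndep : ∀ {N} {u : Fin N → Carrier} → ¬ Dependent u → LinIndep F u
    ¬dependent⇒linIndep ¬dep ξ Fξ ∑≈0 j =
      decidable-stable (≈0? (ξ j) (Fξ j)) (λ ξⱼ≉0 → ¬dep (ξ , Fξ , (j , ξⱼ≉0) , ∑≈0))

    dependent-cong : ∀ {N} {u v : Fin N → Carrier} → (∀ j → u j ≈ v j) → Dependent u → Dependent v
    dependent-cong u≈v (ξ , Fξ , ξ≠0 , ∑≈0) = ξ , Fξ , ξ≠0 , trans (∑-cong (λ j → *-congˡ (sym (u≈v j)))) ∑≈0

    DependentRows : ∀ {N m} → (Fin N → Fin m → Carrier) → Set (r ⊔ ℓ)
    DependentRows C =
      Σ[ ξ ∈ (Fin _ → Carrier) ] (∀ j → F (ξ j)) × Nontrivial ξ × (∀ i → ∑ (λ j → ξ j * C j i) ≈ 0#)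

    dependentRows-zeroColumn : ∀ {N m} (C : Fin N → Fin (suc m) → Carrier) → (∀ j → C j zero ≈ 0#) →
                               DependentRows (λ j i → C j (suc i)) → DependentRows C
    dependentRows-zeroColumn C C₀≈0 (ξ , Fξ , ξ≠0 , ξC≈0) = ξ , Fξ , ξ≠0 , λ where
      zero    → ∑-zero (λ j → trans (*-congˡ (C₀≈0 j)) (zeroʳ (ξ j)))
      (suc i) → ξC≈0 i

    multiplier : ∀ {N m} → (Fin (suc N) → Fin (suc m) → Carrier) → Fin (suc N) → Carrier → Fin N → Carrier
    multiplier C j p' k = - (C (punchIn j k) zero * p')

    -- row k ↦ row k + multiplier k · row j, dropping the pivot row j and the first column,
    -- which these multipliers clear when p' is the inverse of the pivot C j 0
    eliminate : ∀ {N m} → (Fin (suc N) → Fin (suc m) → Carrier) → Fin (suc N) → Carrier → Fin N → Fin m → Carrier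
    eliminate C j p' k i = C (punchIn j k) (suc i) + multiplier C j p' k * C j (suc i)

    multiplier-clears : ∀ {a p p'} → p * p' ≈ 1# → a + - (a * p') * p ≈ 0#
    multiplier-clears {a} {p} {p'} pp'≈1 = begin
      a + - (a * p') * p      ≈⟨ +-congˡ (-‿distribˡ-* (a * p') p) ⟨
      a + - ((a * p') * p)    ≈⟨ +-congˡ (-‿cong (trans (*-assoc a p' p) (*-congˡ (trans (*-comm p' p) pp'≈1)))) ⟩
      a + - (a * 1#)          ≈⟨ +-congˡ (-‿cong (*-identityʳ a)) ⟩
      a + - a                 ≈⟨ -‿inverseʳ a ⟩
      0#                      ∎

    ∑-insertAt : ∀ {N} (b n : Fin N → Carrier) (j : Fin (suc N)) (col : Fin (suc N) → Carrier) →
                 ∑ (λ i → insertAt b j (∑ (λ k → b k * n k)) i * col i) ≈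
                 ∑ (λ k → b k * (col (punchIn j k) + n k * col j))
    ∑-insertAt b n j col = begin
      ∑ (λ i → ξ i * col i)
        ≈⟨ ∑-remove j (λ i → ξ i * col i) ⟩
      ξ j * col j + ∑ (λ k → ξ (punchIn j k) * col (punchIn j k))
        ≈⟨ +-cong (*-congʳ (reflexive (insertAt-lookup b j s)))
                  (∑-cong (λ k → *-congʳ (reflexive (insertAt-punchIn b j s k)))) ⟩
      s * col j + ∑ (λ k → b k * col (punchIn j k))
        ≈⟨ +-comm _ _ ⟩
      ∑ (λ k → b k * col (punchIn j k)) + s * col j
        ≈⟨ +-congˡ (*-distribʳ-∑ (col j) (λ k → b k * n k)) ⟩
      ∑ (λ k → b k * col (punchIn j k)) + ∑ (λ k → (b k * n k) * col j)
        ≈⟨ ∑-distrib-+ (λ k → b k * col (punchIn j k)) (λ k → (b k * n k) * col j) ⟨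
      ∑ (λ k → b k * col (punchIn j k) + (b k * n k) * col j)
        ≈⟨ ∑-cong (λ k → trans (+-congˡ (*-assoc (b k) (n k) (col j))) (sym (distribˡ (b k) _ _))) ⟩
      ∑ (λ k → b k * (col (punchIn j k) + n k * col j)) ∎
      where
      s = ∑ (λ k → b k * n k)
      ξ = insertAt b j s

    insertAt-F : ∀ {N} {b : Fin N → Carrier} {s} → (∀ k → F (b k)) → F s → ∀ j i → F (insertAt b j s i)
    insertAt-F {b = b} {s} Fb Fs j i with i ≟ j
    ... | yes ≡.refl = ≡.subst F (≡.sym (insertAt-lookup b i s)) Fs
    ... | no i≢j = ≡.subst F (≡.trans (≡.sym (insertAt-punchIn b j s _))
                                      (≡.cong (insertAt b j s) (punchIn-punchOut (i≢j ∘ ≡.sym)))) (Fb _)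

    module _ {N m} (C : Fin (suc N) → Fin (suc m) → Carrier) (FC : ∀ j i → F (C j i))
             (j : Fin (suc N)) {p' : Carrier} (Fp' : F p') where

      multiplier-F : ∀ k → F (multiplier C j p' k)
      multiplier-F k = F-neg (F-* (FC (punchIn j k) zero) Fp')

      eliminate-F : ∀ k i → F (eliminate C j p' k i)
      eliminate-F k i = F-+ (FC (punchIn j k) (suc i)) (F-* (multiplier-F k) (FC j (suc i)))

      dependentRows-eliminate : C j zero * p' ≈ 1# → DependentRows (eliminate C j p') → DependentRows C
      dependentRows-eliminate pp'≈1 (b , Fb , (k , bₖ≉0) , bC'≈0) =
        ξ , insertAt-F Fb (∈-∑ F-isSubspace Fb multiplier-F) j , (punchIn j k , ξ≉0) , λ where
          zero    → trans (∑-insertAt b n j (λ l → C l zero))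
                          (∑-zero (λ k → trans (*-congˡ (multiplier-clears pp'≈1)) (zeroʳ (b k))))
          (suc i) → trans (∑-insertAt b n j (λ l → C l (suc i))) (bC'≈0 i)
        where
        n = multiplier C j p'
        ξ = insertAt b j (∑ (λ k → b k * n k))
        ξ≉0 : ¬ (ξ (punchIn j k) ≈ 0#)
        ξ≉0 ξ≈0 = bₖ≉0 (trans (reflexive (≡.sym (insertAt-punchIn b j _ k))) ξ≈0)

    dependentRows : ∀ {m N} → m ≤ N → (C : Fin (suc N) → Fin m → Carrier) → (∀ j i → F (C j i)) → DependentRows C
    dependentRows {zero} _ C FC = (λ _ → 1#) , (λ _ → F-1) , (zero , 1≉0) , λ ()
    dependentRows {suc m} {suc N} (s≤s m≤N) C FC with any? (λ j → ¬? (≈0? (C j zero) (FC j zero)))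
    ... | yes (j , p≉0) =
      let (p' , pp'≈1) = inverse (C j zero) p≉0
          Fp' = F-inv (FC j zero) pp'≈1
      in dependentRows-eliminate C FC j Fp' pp'≈1 (dependentRows m≤N _ (eliminate-F C FC j Fp'))
    ... | no ¬pivot =
      dependentRows-zeroColumn C (λ j → decidable-stable (≈0? (C j zero) (FC j zero)) (λ p≉0 → ¬pivot (j , p≉0)))
        (dependentRows (m≤n⇒m≤1+n m≤N) _ (λ j i → FC j (suc i)))

    dependent-of-span : ∀ {m N} → m ≤ N → (w : Fin m → Carrier) (u : Fin (suc N) → Carrier) →
                        (∀ j → InSpan F w (u j)) → Dependent u
    dependent-of-span m≤N w u u∈ =
      let (ξ , Fξ , ξ≠0 , ξC≈0) = dependentRows m≤N C (λ j → proj₁ (proj₂ (u∈ j)))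
      in ξ , Fξ , ξ≠0 , (begin
        ∑ (λ j → ξ j * u j)                        ≈⟨ ∑-cong {f = λ j → ξ j * u j} (λ j → *-congˡ (proj₂ (proj₂ (u∈ j)))) ⟩
        ∑ (λ j → ξ j * ∑ (λ i → C j i * w i))      ≈⟨ ∑-lincomb-comm ξ C w ⟩
        ∑ (λ i → ∑ (λ j → ξ j * C j i) * w i)      ≈⟨ ∑-zero (λ i → trans (*-congʳ (ξC≈0 i)) (zeroˡ (w i))) ⟩
        0#                                         ∎)
      where
      C : Fin _ → Fin _ → Carrier
      C j = proj₁ (u∈ j)

    ¬linIndep-in-smaller-span : ∀ {m N} → m ≤ N → {w : Fin m → Carrier} {u : Fin (suc N) → Carrier} →
                                LinIndep F u → (∀ j → InSpan F w (u j)) → ⊥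
    ¬linIndep-in-smaller-span m≤N {w} {u} u-indep u∈ = linIndep⇒¬dependent {u = u} u-indep (dependent-of-span m≤N w u u∈)

    head-∈ : ∀ {P} → IsSubspace F P → ∀ {N} {u : Fin N → Carrier} → (∀ i → P (u i)) → LinIndep F u →
             ∀ {x} → Dependent (x ∷ u) → P x
    head-∈ P-sub {u = u} u∈P u-indep (a , Fa , a≠0 , ∑≈0) with ≈0? (a zero) (Fa zero)
    ... | no a₀≉0 = isolate-∈ P-sub (Fa zero) a₀≉0 ∑≈0 (∈-∑ P-sub (Fa ∘ suc) u∈P)
    ... | yes a₀≈0 = ⊥-elim (linIndep⇒¬dependent {u = u} u-indep
          (a ∘ suc , Fa ∘ suc , nontrivial-tail a₀≈0 a≠0 ,
           trans (sym (+-identityˡ _)) (trans (+-congʳ (sym (trans (*-congʳ a₀≈0) (zeroˡ _)))) ∑≈0)))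

    cons-linIndep : ∀ {P} → IsSubspace F P → ∀ {N} {u : Fin N → Carrier} → (∀ i → P (u i)) → LinIndep F u →
                    ∀ {x} → ¬ P x → LinIndep F (x ∷ u)
    cons-linIndep P-sub {u = u} u∈P u-indep {x} x∉P =
      ¬dependent⇒linIndep {u = x ∷ u} (x∉P ∘ head-∈ P-sub u∈P u-indep)

    Stabilizer : Subset → Subset
    Stabilizer W x = ∀ v → W v → W (x * v)

    ∑-powers-step : ∀ {N} x v (b : Fin (suc N) → Carrier) →
                    ∑ (λ j → b j * (pow x (toℕ j) * v)) ≈
                    b zero * v + x * ∑ (λ j → b (suc j) * (pow x (toℕ j) * v))
    ∑-powers-step x v b = +-cong (*-congˡ (*-identityˡ v)) (begin
      ∑ (λ j → b (suc j) * ((x * pow x (toℕ j)) * v))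
        ≈⟨ ∑-cong (λ j → trans (*-congˡ (*-assoc x _ v)) (x∙yz≈y∙xz (b (suc j)) x _)) ⟩
      ∑ (λ j → x * (b (suc j) * (pow x (toℕ j) * v)))
        ≈⟨ *-distribˡ-∑ x (λ j → b (suc j) * (pow x (toℕ j) * v)) ⟨
      x * ∑ (λ j → b (suc j) * (pow x (toℕ j) * v)) ∎)

    module _ {W : Subset} (W-sub : IsSubspace F W) where

      pow-∈ : ∀ {x v} → Stabilizer W x → W v → ∀ j → W (pow x j * v)
      pow-∈ {x} {v} x∈ v∈ zero    = ∈-resp W-sub (sym (*-identityˡ v)) v∈
      pow-∈ {x} {v} x∈ v∈ (suc j) = ∈-resp W-sub (sym (*-assoc x (pow x j) v)) (x∈ _ (pow-∈ x∈ v∈ j))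

      -- A relation b₀ v + x R = 0 with b₀ ≠ 0 gives y v = - b₀⁻¹ R; if b₀ = 0 then R = 0 is a shorter relation.
      dependent-powers⇒inverse-∈ : ∀ {N x y v} → x * y ≈ 1# → (∀ (j : Fin N) → W (pow x (toℕ j) * v)) →
                                   Dependent (λ (j : Fin N) → pow x (toℕ j) * v) → W (y * v)
      dependent-powers⇒inverse-∈ {zero} _ _ (_ , _ , (() , _) , _)
      dependent-powers⇒inverse-∈ {suc N} {x} {y} {v} xy≈1 xʲv∈W (b , Fb , b≠0 , ∑≈0) =
        case-leading (≈0? (b zero) (Fb zero))
        where
        R = ∑ (λ j → b (suc j) * (pow x (toℕ j) * v))

        init∈W : ∀ (j : Fin N) → W (pow x (toℕ j) * v)
        init∈W j = ∈-resp W-sub (*-congʳ (reflexive (≡.cong (pow x) (toℕ-inject₁ j)))) (xʲv∈W (inject₁ j))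

        b₀v+xR≈0 : b zero * v + x * R ≈ 0#
        b₀v+xR≈0 = trans (sym (∑-powers-step x v b)) ∑≈0

        case-leading : Dec (b zero ≈ 0#) → W (y * v)
        case-leading (no b₀≉0) = isolate-∈ W-sub (Fb zero) b₀≉0 (begin
          b zero * (y * v) + R               ≈⟨ +-cong (x∙yz≈y∙xz (b zero) y v) (trans (sym (*-identityˡ R)) (*-congʳ (sym xy≈1))) ⟩
          y * (b zero * v) + (x * y) * R     ≈⟨ +-congˡ (xy∙z≈y∙xz x y R) ⟩
          y * (b zero * v) + y * (x * R)     ≈⟨ distribˡ y (b zero * v) (x * R) ⟨
          y * (b zero * v + x * R)           ≈⟨ *-congˡ b₀v+xR≈0 ⟩
          y * 0#                             ≈⟨ zeroʳ y ⟩
          0#                                 ∎) (∈-∑ W-sub (Fb ∘ suc) init∈W)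
        case-leading (yes b₀≈0) = dependent-powers⇒inverse-∈ xy≈1 init∈W
          (b ∘ suc , Fb ∘ suc , nontrivial-tail b₀≈0 b≠0 , inverse-cancel xy≈1 (begin
            x * R                   ≈⟨ +-identityˡ (x * R) ⟨
            0# + x * R              ≈⟨ +-congʳ (trans (*-congʳ b₀≈0) (zeroˡ v)) ⟨
            b zero * v + x * R      ≈⟨ b₀v+xR≈0 ⟩
            0#                      ∎))

    module _ {k} (w : Fin k → Carrier) where

      private
        W-sub = span-isSubspace w

      stabilizer-inverse : ∀ {x y} → Stabilizer (InSpan F w) x → x * y ≈ 1# → Stabilizer (InSpan F w) y
      stabilizer-inverse x∈ xy≈1 v v∈ =
        dependent-powers⇒inverse-∈ W-sub xy≈1 xʲv∈W (dependent-of-span ≤-refl w _ xʲv∈W)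
        where
        xʲv∈W : ∀ (j : Fin (suc k)) → InSpan F w (pow _ (toℕ j) * v)
        xʲv∈W j = pow-∈ W-sub x∈ v∈ (toℕ j)

      stabilizer-isSubfield : IsSubfield (Stabilizer (InSpan F w))
      stabilizer-isSubfield =
          (λ x≈y x∈ v v∈ → ∈-resp W-sub (*-congʳ x≈y) (x∈ v v∈))
        , (λ v _ → ∈-resp W-sub (sym (zeroˡ v)) (∈-0 W-sub))
        , (λ v v∈ → ∈-resp W-sub (sym (*-identityˡ v)) v∈)
        , (λ x y x∈ y∈ v v∈ → ∈-resp W-sub (sym (distribʳ v x y)) (∈-+ W-sub (x∈ v v∈) (y∈ v v∈)))
        , (λ x x∈ v v∈ → ∈-resp W-sub (-‿distribˡ-* x v) (∈-neg W-sub (x∈ v v∈)))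
        , (λ x y x∈ y∈ v v∈ → ∈-resp W-sub (sym (*-assoc x y v)) (x∈ _ (y∈ v v∈)))
        , (λ _ _ → stabilizer-inverse)

      F⊆stabilizer : ∀ a → F a → Stabilizer (InSpan F w) a
      F⊆stabilizer a Fa v v∈ = ∈-* W-sub Fa v∈

      stabilizer-of-generators : ∀ {x} → (∀ i → InSpan F w (x * w i)) → Stabilizer (InSpan F w) x
      stabilizer-of-generators {x} xw∈ v (a , Fa , v≈) =
        ∈-resp W-sub (sym (trans (*-congˡ v≈) (*-lincomb x a w))) (∈-∑ W-sub Fa xw∈)

    module Generated {γ : Carrier} (γ≉0 : ¬ (γ ≈ 0#)) (gen : Generates F γ) where

      -- g ∈ Stab W forces γ = g⁻¹ ∈ Stab W, hence Stab W = K, and x = (x γ) g ∈ W.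
      span-total : ∀ {k} (w : Fin k → Carrier) {g} → g * γ ≈ 1# → InSpan F w g →
                   Stabilizer (InSpan F w) g → ∀ x → InSpan F w x
      span-total w {g} gγ≈1 g∈W g∈Stab x =
        ∈-resp (span-isSubspace w) xγ∙g≈x (everything∈Stab (x * γ) g g∈W)
        where
        everything∈Stab : ∀ y → Stabilizer (InSpan F w) y
        everything∈Stab = gen _ (stabilizer-isSubfield w) (F⊆stabilizer w) (stabilizer-inverse w g∈Stab gγ≈1)
        xγ∙g≈x : (x * γ) * g ≈ x
        xγ∙g≈x = trans (*-assoc x γ g) (trans (*-congˡ (trans (*-comm γ g) gγ≈1)) (*-identityʳ x))

      powers-linIndep : ∀ {p k} {E : Fin (suc p) → Carrier} → k ≤ p → LinIndep F E →
                        LinIndep F (λ (i : Fin k) → pow γ (toℕ i))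
      powers-linIndep {k = k} {E} k≤p E-indep = ¬dependent⇒linIndep λ dep →
        ¬linIndep-in-smaller-span k≤p {u = E} E-indep (λ l → span-total w gγ≈1 (g∈W dep) (g∈Stab dep) (E l))
        where
        w : Fin k → Carrier
        w i = pow γ (toℕ i)
        W-sub = span-isSubspace w
        g = proj₁ (inverse γ γ≉0)
        γg≈1 = proj₂ (inverse γ γ≉0)
        gγ≈1 = trans (*-comm g γ) γg≈1

        g∈W : Dependent w → InSpan F w g
        g∈W dep = ∈-resp W-sub (*-identityʳ g)
          (dependent-powers⇒inverse-∈ W-sub γg≈1 (λ j → ∈-resp W-sub (sym (*-identityʳ (w j))) (span-∈ w j))
                                                 (dependent-cong (λ j → sym (*-identityʳ (w j))) dep))

        g∈Stab : Dependent w → Stabilizer (InSpan F w) g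
        g∈Stab dep = stabilizer-of-generators w λ where
          zero    → ∈-resp W-sub (sym (*-identityʳ g)) (g∈W dep)
          (suc i) → ∈-resp W-sub (begin
            pow γ (toℕ (inject₁ i))    ≈⟨ reflexive (≡.cong (pow γ) (toℕ-inject₁ i)) ⟩
            pow γ (toℕ i)              ≈⟨ *-identityˡ _ ⟨
            1# * pow γ (toℕ i)         ≈⟨ *-congʳ gγ≈1 ⟨
            (g * γ) * pow γ (toℕ i)    ≈⟨ *-assoc g γ _ ⟩
            g * w (suc i)              ∎) (span-∈ w (inject₁ i))

    scale-span⇒span-scaled : ∀ {m} {w : Fin m → Carrier} {a x} → scale a (InSpan F w) x → InSpan F (λ i → a * w i) x
    scale-span⇒span-scaled {w = w} {a} (y , (b , Fb , y≈) , x≈ay) =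
      b , Fb , trans x≈ay (trans (*-congˡ y≈) (*-lincomb a b w))

    span-scaled⇒scale-span : ∀ {m} {w : Fin m → Carrier} {a x} → InSpan F (λ i → a * w i) x → scale a (InSpan F w) x
    span-scaled⇒scale-span {w = w} {a} (b , Fb , x≈) =
      ∑ (λ i → b i * w i) , (b , Fb , refl) , trans x≈ (sym (*-lincomb a b w))

    scale-linIndep : ∀ {m} {w : Fin m → Carrier} {a} → ¬ (a ≈ 0#) → LinIndep F w → LinIndep F (λ i → a * w i)
    scale-linIndep {w = w} {a} a≉0 w-indep b Fb ∑≈0 =
      w-indep b Fb (inverse-cancel (proj₂ (inverse a a≉0)) (trans (*-lincomb a b w) ∑≈0))

    module Hyperplane {q} (F-card : HasCard F q)
                      {p} {E : Fin (suc p) → Carrier} (E-indep : LinIndep F E) (E-spans : ∀ x → InSpan F E x)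
                      {S : Subset} (S-sub : IsSubspace F S)
                      {B : Fin p → Carrier} (B∈S : ∀ i → S (B i)) (B-indep : LinIndep F B)
                      (B-spans : ∀ x → S x → InSpan F B x) where

      _≈?_ : ∀ x y → Dec (x ≈ y)
      x ≈? y = map′ coords≈0⇒≈ ≈⇒coords≈0 (all? (λ i → ≈0? (a i) (proj₁ (proj₂ x-y∈E) i)))
        where
        x-y∈E = E-spans (x + - y)
        a = proj₁ x-y∈E

        coords≈0⇒≈ : (∀ i → a i ≈ 0#) → x ≈ y
        coords≈0⇒≈ a≈0 = x∙y⁻¹≈ε⇒x≈y x y
          (trans (proj₂ (proj₂ x-y∈E)) (∑-zero (λ i → trans (*-congʳ (a≈0 i)) (zeroˡ (E i)))))

        ≈⇒coords≈0 : x ≈ y → ∀ i → a i ≈ 0#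
        ≈⇒coords≈0 x≈y = E-indep a (proj₁ (proj₂ x-y∈E)) (trans (sym (proj₂ (proj₂ x-y∈E))) (x≈y⇒x∙y⁻¹≈ε x≈y))

      span? : ∀ {m} (w : Fin m → Carrier) x → Dec (InSpan F w x)
      span? {zero} w x = map′ (λ x≈0 → (λ ()) , (λ ()) , x≈0) (proj₂ ∘ proj₂) (x ≈? 0#)
      span? {suc m} w x = map′ from to (any? (λ i → span? (w ∘ suc) (- (f i * w zero) + x)))
        where
        f = proj₁ F-card
        f-onto = proj₂ (proj₂ (proj₂ F-card))

        from : ∃[ i ] InSpan F (w ∘ suc) (- (f i * w zero) + x) → InSpan F w x
        from (i , a , Fa , rest≈) =
          (f i ∷ a) , (λ { zero → proj₁ (proj₂ F-card) i ; (suc j) → Fa j }) ,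
          trans (sym (\\-leftDividesˡ (f i * w zero) x)) (+-congˡ rest≈)

        to : InSpan F w x → ∃[ i ] InSpan F (w ∘ suc) (- (f i * w zero) + x)
        to (a , Fa , x≈) = i , a ∘ suc , Fa ∘ suc ,
          trans (+-congʳ (-‿cong (*-congʳ fi≈a₀))) (sym (y≈x\\z (a zero * w zero) _ x (sym x≈)))
          where
          i = proj₁ (f-onto (a zero) (Fa zero))
          fi≈a₀ = proj₂ (f-onto (a zero) (Fa zero))

      ∃∉S : ∃[ e ] ¬ S e
      ∃∉S with all? (λ l → span? B (E l))
      ... | yes E⊆S = ⊥-elim (¬linIndep-in-smaller-span ≤-refl E-indep E⊆S)
      ... | no E⊈S = let (l , E∉S) = ¬∀⟶∃¬ _ _ (span? B ∘ E) E⊈S in E l , E∉S ∘ B-spans (E l)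

      e : Carrier
      e = proj₁ ∃∉S

      e∷B-spans : ∀ x → InSpan F (e ∷ B) x
      e∷B-spans x = head-∈ (span-isSubspace (e ∷ B)) (span-∈ (e ∷ B))
        (cons-linIndep S-sub B∈S B-indep (proj₂ ∃∉S))
        (dependent-of-span ≤-refl E (x ∷ e ∷ B) (λ _ → E-spans _))

      -- c ↦ (e-coordinate of c gᵢ)ᵢ is F-linear from a (p+1)-dimensional space to Fᵖ, so it has a nonzero kernel.
      common-multiplier : (g : Fin p → Carrier) → ∃[ c ] ¬ (c ≈ 0#) × (∀ i → S (c * g i))
      common-multiplier g = c , c≉0 , cg∈S
        where
        coords : Fin (suc p) → Fin p → Fin (suc p) → Carrier
        coords l i = proj₁ (e∷B-spans (E l * g i))

        F-coords : ∀ l i r → F (coords l i r)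
        F-coords l i = proj₁ (proj₂ (e∷B-spans (E l * g i)))

        α : Fin (suc p) → Fin p → Carrier
        α l i = coords l i zero

        σ : Fin (suc p) → Fin p → Carrier
        σ l i = ∑ (λ r → coords l i (suc r) * B r)

        Eg≈αe+σ : ∀ l i → E l * g i ≈ α l i * e + σ l i
        Eg≈αe+σ l i = proj₂ (proj₂ (e∷B-spans (E l * g i)))

        solution = dependentRows ≤-refl α (λ l i → F-coords l i zero)
        ξ = proj₁ solution
        Fξ = proj₁ (proj₂ solution)
        ξα≈0 = proj₂ (proj₂ (proj₂ solution))

        c : Carrier
        c = ∑ (λ l → ξ l * E l)

        c≉0 : ¬ (c ≈ 0#)
        c≉0 c≈0 = linIndep⇒¬dependent {u = E} E-indep (ξ , Fξ , proj₁ (proj₂ (proj₂ solution)) , c≈0)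

        cg∈S : ∀ i → S (c * g i)
        cg∈S i = ∈-resp S-sub (sym (begin
          c * g i
            ≈⟨ *-distribʳ-∑ (g i) (λ l → ξ l * E l) ⟩
          ∑ (λ l → (ξ l * E l) * g i)
            ≈⟨ ∑-cong (λ l → trans (*-assoc (ξ l) (E l) (g i)) (*-congˡ (Eg≈αe+σ l i))) ⟩
          ∑ (λ l → ξ l * (α l i * e + σ l i))
            ≈⟨ ∑-cong (λ l → trans (distribˡ (ξ l) (α l i * e) (σ l i)) (+-congʳ (sym (*-assoc (ξ l) (α l i) e)))) ⟩
          ∑ (λ l → (ξ l * α l i) * e + ξ l * σ l i)
            ≈⟨ ∑-distrib-+ (λ l → (ξ l * α l i) * e) (λ l → ξ l * σ l i) ⟩
          ∑ (λ l → (ξ l * α l i) * e) + ∑ (λ l → ξ l * σ l i)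
            ≈⟨ +-congʳ (*-distribʳ-∑ e (λ l → ξ l * α l i)) ⟨
          ∑ (λ l → ξ l * α l i) * e + ∑ (λ l → ξ l * σ l i)
            ≈⟨ +-congʳ (trans (*-congʳ (ξα≈0 i)) (zeroˡ e)) ⟩
          0# + ∑ (λ l → ξ l * σ l i)
            ≈⟨ +-identityˡ _ ⟩
          ∑ (λ l → ξ l * σ l i) ∎))
          (∈-∑ S-sub Fξ (λ l → ∈-∑ S-sub (λ r → F-coords l i (suc r)) B∈S))

      hyperplane-scaled-powers : ∀ {γ} → ¬ (γ ≈ 0#) → Generates F γ →
        ∃[ c ] (¬ (c ≈ 0#) × SameSet S (scale c (InSpan F (λ (i : Fin p) → pow γ (toℕ i)))))
      hyperplane-scaled-powers {γ} γ≉0 gen = c , c≉0 , λ x → mk⇔ (S⊆cT x) (cT⊆S x)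
        where
        open Generated γ≉0 gen

        γⁱ : Fin p → Carrier
        γⁱ i = pow γ (toℕ i)

        c = proj₁ (common-multiplier γⁱ)
        c≉0 = proj₁ (proj₂ (common-multiplier γⁱ))
        cγⁱ∈S = proj₂ (proj₂ (common-multiplier γⁱ))

        cγⁱ : Fin p → Carrier
        cγⁱ i = c * γⁱ i

        cγⁱ-indep : LinIndep F cγⁱ
        cγⁱ-indep = scale-linIndep c≉0 (powers-linIndep {E = E} ≤-refl E-indep)

        cT⊆S : ∀ x → scale c (InSpan F γⁱ) x → S x
        cT⊆S x = span-⊆ S-sub cγⁱ∈S ∘ scale-span⇒span-scaled

        S⊆cT : ∀ x → S x → scale c (InSpan F γⁱ) x
        S⊆cT x x∈S = span-scaled⇒scale-span (head-∈ (span-isSubspace cγⁱ) (span-∈ cγⁱ) cγⁱ-indep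
          (dependent-of-span ≤-refl B (x ∷ cγⁱ) λ where
            zero    → B-spans x x∈S
            (suc i) → B-spans (cγⁱ i) (cγⁱ∈S i)))

proposition2p5 : ∀ {c ℓ : Level} (K : CommutativeRing c ℓ) →
    let open CommutativeRing K
        open FieldTheory K
    in ∀ (q n : ℕ) (F S : Subset) (γ : Carrier) →
       IsPrimePower q → 2 ≤ n →
       IsField → IsFinite →
       IsSubfield F → HasCard F q → HasDim F (λ _ → ⊤) n →
       IsSubspace F S → HasDim F S (n ∸ 1) →
       ¬ (γ ≈ 0#) → Generates F γ →
       ∃[ a ] (¬ (a ≈ 0#) × SameSet S (scale a (InSpan F {n ∸ 1} (λ i → pow γ (toℕ i)))))
proposition2p5 K q (suc p) F S γ _ (s≤s _) isField _ F-subfield F-card (E , _ , E-indep , E-spans)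
               S-sub (B , B∈S , B-indep , B-spans) γ≉0 gen =
  hyperplane-scaled-powers γ≉0 gen
  where
  open LinearAlgebra K
  open OverSubfield isField F-subfield (λ x Fx → hasCard⇒≈? F-card Fx (proj₁ (proj₂ F-subfield)))
  open Hyperplane F-card {E = E} E-indep (λ x → E-spans x _) S-sub {B = B} B∈S B-indep B-spans
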